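{- For every $n \geq 1$, the number $t_n(321)$ of shallow permutations of length $n$ that avoid $321$ equals $F_{2n-1}$, the $(2n-1)$-st Fibonacci number.
   Context: For $\pi=\pi_1\cdots\pi_n \in S_n$: $D(\pi)=\sum_{i=1}^n|\pi_i-i|$; $I(\pi)=|\{(i,j): i<j,\ \pi_i>\pi_j\}|$; $T(\pi)=n-\mathrm{cyc}(\pi)$ where $\mathrm{cyc}(\pi)$ is the number of cycles of $\pi$. $\pi$ is shallow if $I(\pi)+T(\pi)=D(\pi)$. $\pi$ avoids $321$ if there are no $i<j<k$ with $\pi_i>\pi_j>\pi_k$. Fibonacci numbers: $F_1=F_2=1$, $F_m=F_{m-1}+F_{m-2}$. -}

module Defs where

open import Data.Nat.Base using (ℕ; zero; suc; _+_; _∸_; ∣_-_∣; _<ᵇ_; _≡ᵇ_)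
open import Data.Fin.Base using (Fin; toℕ)
open import Data.Vec.Base using (Vec; []; _∷_; lookup)
open import Data.List.Base using (List; []; _∷_; allFin; map; concatMap; length; filterᵇ)
open import Data.Nat.ListAction using (sum)
open import Data.Bool.ListAction using (all; any)
open import Data.Bool.Base using (Bool; true; false; _∧_; not)

-- A candidate word π = π₁⋯πₙ of length n over [n] is a vector of n entries in Fin n
-- (positions and values are 0-based; this shifts both by 1, which changes none of
-- D, I, cycles, or the 321-pattern condition).
Word : ℕ → Set
Word n = Vec (Fin n) n

allVecs : (m k : ℕ) → List (Vec (Fin m) k)
allVecs m zero    = [] ∷ []
allVecs m (suc k) = concatMap (λ x → map (x ∷_) (allVecs m k)) (allFin m)

val : ∀ {n} → Word n → Fin n → ℕ
val π i = toℕ (lookup π i)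

isPerm : ∀ {n} → Word n → Bool
isPerm {n} π =
  all (λ i → all (λ j → not (toℕ i <ᵇ toℕ j) ∨' not (val π i ≡ᵇ val π j)) (allFin n)) (allFin n)
  where
  _∨'_ : Bool → Bool → Bool
  true  ∨' _ = true
  false ∨' b = b

D : ∀ {n} → Word n → ℕ
D {n} π = sum (map (λ i → ∣ val π i - toℕ i ∣) (allFin n))

countᵇ : ∀ {A : Set} → (A → Bool) → List A → ℕ
countᵇ p xs = length (filterᵇ p xs)

I : ∀ {n} → Word n → ℕ
I {n} π = sum (map (λ i → countᵇ (λ j → (toℕ i <ᵇ toℕ j) ∧ (val π j <ᵇ val π i)) (allFin n)) (allFin n))

iter : ∀ {n} → Word n → ℕ → Fin n → Fin n
iter π zero    i = i
iter π (suc k) i = lookup π (iter π k i)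

-- number of cycles of π: each cycle is counted once, via its least element
-- (i is the least element of its cycle iff toℕ i ≤ toℕ (π^k i) for k = 1..n)
isCycleMin : ∀ {n} → Word n → Fin n → Bool
isCycleMin {n} π i = all (λ k → not (toℕ (iter π (suc (toℕ k)) i) <ᵇ toℕ i)) (allFin n)

cyc : ∀ {n} → Word n → ℕ
cyc {n} π = countᵇ (isCycleMin π) (allFin n)

T : ∀ {n} → Word n → ℕ
T {n} π = n ∸ cyc π

shallow : ∀ {n} → Word n → Bool
shallow π = (I π + T π) ≡ᵇ D π

contains321 : ∀ {n} → Word n → Bool
contains321 {n} π =
  any (λ i → any (λ j → any (λ k →
        (toℕ i <ᵇ toℕ j) ∧ (toℕ j <ᵇ toℕ k) ∧ (val π j <ᵇ val π i) ∧ (val π k <ᵇ val π j))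
      (allFin n)) (allFin n)) (allFin n)

avoids321 : ∀ {n} → Word n → Bool
avoids321 π = not (contains321 π)

t321 : ℕ → ℕ
t321 n = countᵇ (λ π → isPerm π ∧ shallow π ∧ avoids321 π) (allVecs n n)

fib : ℕ → ℕ
fib zero          = 0
fib (suc zero)    = 1
fib (suc (suc m)) = fib (suc m) + fib m

{-# OPTIONS --safe #-}

-- Every permutation of length m + 1 is uniquely prepend x σ = (0 x) ∘ (1 ⊕ σ) for a permutation σ of length m.
-- For x = 0 nothing changes except for one more cycle.  For x = c + 1 and k = σ⁻¹ c the transposition merges the
-- fixed point 0 into the cycle through c + 1, so T grows by 1, while D grows by 2 + 2 min(c, k) and I by 1 + 2 g,
-- where g ≤ min(c, k) counts the positions i < k with σ i < c.  By induction I + T ≤ D for all permutations, so π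
-- is shallow iff σ is and g = min(c, k).  If π avoids 321 then g = 0 (such an i gives the pattern c + 1, σ i + 1,
-- 0), hence c = 0 or k = 0, and in that case 321 passes between σ and π in both directions.  So the shallow
-- 321-avoiders of length m + 1 are the prepend x σ with σ one of length m and x ∈ {0, 1, σ₀ + 1}.  Counting them
-- by their first entry, G(n) = t_n(321) and N(m) = #{those of length m + 1 not starting with 0} satisfy G(m+1) =
-- G(m) + N(m) and N(m+1) = G(m+1) + N(m), whence G(m+1) = F(2m+1) and N(m) = F(2m).

module Submission where

open import Defs
-- Defs uses T for the reflection length.
open import Data.Bool.Base using (Bool; true; false; _∧_; not; if_then_else_) renaming (T to So)
open import Data.Bool.ListAction using (all; any)
open import Data.Bool.Properties using (T-∧; T?; T-≡; ∧-zeroʳ; ∧-identityʳ; ∧-assoc)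
open import Data.Empty using (⊥-elim)
open import Data.Fin.Base using (Fin; zero; suc; toℕ; fromℕ<; punchIn; punchOut)
open import Data.Fin.Properties
  using ( _≟_; toℕ-fromℕ<; pigeonhole; toℕ-injective; 0≢1+n; suc-injective; toℕ<n
        ; punchInᵢ≢i; punchIn-punchOut; punchOut-injective)
open import Data.List.Base using (List; []; _∷_; allFin; map; tabulate; concatMap; length; filterᵇ; _++_)
open import Data.List.Membership.Propositional using (lose)
open import Data.List.Membership.Propositional.Properties using (∈-allFin)
open import Data.List.Properties
  using (filter-≐; filter-++; length-++; map-cong; map-tabulate; length-filter; length-tabulate)
import Data.List.Relation.Unary.All as All
open import Data.List.Relation.Unary.All.Properties using (all⁺; all⁻; ¬All⇒Any¬)
open import Data.List.Relation.Unary.Any using (satisfied)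
open import Data.List.Relation.Unary.Any.Properties using (any⁺; any⁻)
open import Data.Nat.Base
  using (ℕ; zero; suc; _+_; _*_; _∸_; _⊓_; _≤_; _<_; z≤n; s≤s; s≤s⁻¹; _<ᵇ_; _≡ᵇ_; ∣_-_∣)
open import Data.Nat.ListAction using (sum)
open import Data.Nat.Properties as ℕ hiding (_≟_; suc-injective; 0≢1+n)
open import Data.Nat.Tactic.RingSolver using (solve-∀)
open import Algebra.Properties.CommutativeMonoid.Sum +-0-commutativeMonoid
  using (sum-remove; sum-cong-≗; ∑-distrib-+; sum-syntax) renaming (sum to ∑)
open import Data.Product using (∃; _×_; _,_; proj₁; proj₂)
open import Data.Sum using (_⊎_; inj₁; inj₂)
open import Data.Vec.Base as Vec using (Vec; []; _∷_; lookup)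
open import Data.Vec.Properties using (lookup-map; lookup∘tabulate; tabulate-∘; tabulate-cong; tabulate∘lookup)
open import Function using (_∘_; id; _⇔_; mk⇔; Equivalence)
open import Function.Definitions using (Injective)
open import Relation.Binary.PropositionalEquality
open import Relation.Binary.Definitions using (tri<; tri≈; tri>)
open import Relation.Nullary using (does; ¬_; yes; no)
open import Relation.Nullary.Decidable using (⌊_⌋; dec-true; dec-false; decidable-stable; toWitness; fromWitness)

open ≡-Reasoning

open Equivalence using (to; from)

So-not⁺ : ∀ {b} → So (not b) → ¬ So b
So-not⁺ {false} _ ()

So-not⁻ : ∀ {b} → ¬ So b → So (not b)
So-not⁻ {false} _   = _
So-not⁻ {true}  ¬so = ¬so _

So-ext : ∀ {a b} → So a ⇔ So b → a ≡ b
So-ext {false} {false} _   = refl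
So-ext {false} {true}  a⇔b = ⊥-elim (from a⇔b _)
So-ext {true}  {false} a⇔b = ⊥-elim (to a⇔b _)
So-ext {true}  {true}  _   = refl

indicator : Bool → ℕ
indicator true  = 1
indicator false = 0

indicator-false : ∀ {b} → ¬ So b → indicator b ≡ 0
indicator-false {false} _   = refl
indicator-false {true}  ¬so = ⊥-elim (¬so _)

<ᵇ-false : ∀ {a b} → ¬ a < b → (a <ᵇ b) ≡ false
<ᵇ-false {a} {b} a≮b with a <ᵇ b in eq
... | false = refl
... | true  = ⊥-elim (a≮b (<ᵇ⇒< a b (from T-≡ eq)))

<ᵇ-true : ∀ {a b} → a < b → (a <ᵇ b) ≡ true
<ᵇ-true a<b = to T-≡ (<⇒<ᵇ a<b)

indicator-dichotomy : ∀ {a b} → a ≢ b → indicator (b <ᵇ a) + indicator (a <ᵇ b) ≡ 1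
indicator-dichotomy {a} {b} a≢b with <-cmp a b
... | tri< a<b _ b≮a rewrite <ᵇ-true a<b | <ᵇ-false b≮a = refl
... | tri≈ _ a≡b _   = ⊥-elim (a≢b a≡b)
... | tri> a≮b _ b<a rewrite <ᵇ-false a≮b | <ᵇ-true b<a = refl

indicator-split : ∀ {a b} → a ≢ b → ∀ x → indicator ((a <ᵇ b) ∧ x) + indicator ((b <ᵇ a) ∧ x) ≡ indicator x
indicator-split {a} {b} a≢b x with <-cmp a b
... | tri< a<b _ b≮a rewrite <ᵇ-true a<b | <ᵇ-false b≮a = +-identityʳ (indicator x)
... | tri≈ _ a≡b _   = ⊥-elim (a≢b a≡b)
... | tri> a≮b _ b<a rewrite <ᵇ-false a≮b | <ᵇ-true b<a = refl

-- Finite sums and counting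

∑-zero : ∀ {n} {f : Fin n → ℕ} → (∀ i → f i ≡ 0) → ∑ f ≡ 0
∑-zero {zero}  _   = refl
∑-zero {suc n} f≡0 = cong₂ _+_ (f≡0 zero) (∑-zero (f≡0 ∘ suc))

∑-mono-≤ : ∀ {n} {f g : Fin n → ℕ} → (∀ i → f i ≤ g i) → ∑ f ≤ ∑ g
∑-mono-≤ {zero}  _   = z≤n
∑-mono-≤ {suc n} f≤g = +-mono-≤ (f≤g zero) (∑-mono-≤ (f≤g ∘ suc))

∑-reindex : ∀ {n} (τ : Fin n → Fin n) → Injective _≡_ _≡_ τ → (f : Fin n → ℕ) → ∑ (f ∘ τ) ≡ ∑ f
∑-reindex {zero}  τ τ-inj f = refl
∑-reindex {suc n} τ τ-inj f = begin
  f (τ zero) + ∑ (f ∘ τ ∘ suc)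
    ≡⟨ cong (f (τ zero) +_) (sum-cong-≗ (λ i → cong f (sym (punchIn-punchOut (τ₀≢ i))))) ⟩
  f (τ zero) + ∑ (f ∘ punchIn (τ zero) ∘ τ′)
    ≡⟨ cong (f (τ zero) +_) (∑-reindex τ′ τ′-inj (f ∘ punchIn (τ zero))) ⟩
  f (τ zero) + ∑ (f ∘ punchIn (τ zero))
    ≡⟨ sym (sum-remove f) ⟩
  ∑ f
    ∎
  where
  τ₀≢ : ∀ i → τ zero ≢ τ (suc i)
  τ₀≢ i eq with () ← τ-inj eq
  τ′ : Fin n → Fin n
  τ′ i = punchOut (τ₀≢ i)
  τ′-inj : Injective _≡_ _≡_ τ′
  τ′-inj eq with refl ← τ-inj (punchOut-injective (τ₀≢ _) (τ₀≢ _) eq) = refl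

∑-single : ∀ {n} (k : Fin n) {f : Fin n → ℕ} → (∀ i → i ≢ k → f i ≡ 0) → ∑ f ≡ f k
∑-single {suc n} k {f} f≡0 = begin
  ∑ f                      ≡⟨ sum-remove {i = k} f ⟩
  f k + ∑ (f ∘ punchIn k)  ≡⟨ cong (f k +_) (∑-zero (λ w → f≡0 _ (punchInᵢ≢i k w))) ⟩
  f k + 0                  ≡⟨ +-identityʳ (f k) ⟩
  f k                      ∎

∑-agree-except : ∀ {n} (k : Fin n) {f g : Fin n → ℕ} → (∀ i → i ≢ k → f i ≡ g i) → ∑ f + g k ≡ ∑ g + f k
∑-agree-except {suc n} k {f} {g} f≡g = begin
  ∑ f + g k
    ≡⟨ cong (_+ g k) (sum-remove {i = k} f) ⟩
  f k + ∑ (f ∘ punchIn k) + g k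
    ≡⟨ cong (λ s → f k + s + g k) (sum-cong-≗ (λ w → f≡g _ (punchInᵢ≢i k w))) ⟩
  f k + ∑ (g ∘ punchIn k) + g k
    ≡⟨ outer-swap (f k) _ (g k) ⟩
  g k + ∑ (g ∘ punchIn k) + f k
    ≡⟨ cong (_+ f k) (sym (sum-remove {i = k} g)) ⟩
  ∑ g + f k
    ∎
  where
  outer-swap : ∀ a s b → a + s + b ≡ b + s + a
  outer-swap = solve-∀

∑-indicator-< : ∀ {n} v → v ≤ n → ∑[ i < n ] indicator (toℕ i <ᵇ v) ≡ v
∑-indicator-< {zero}  zero    _         = refl
∑-indicator-< {suc n} zero    _         = ∑-zero {suc n} (λ _ → refl)
∑-indicator-< {suc n} (suc v) (s≤s v≤n) = cong suc (∑-indicator-< v v≤n)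

countᵇ-cong : ∀ {A : Set} {p q : A → Bool} → (∀ x → p x ≡ q x) → ∀ xs → countᵇ p xs ≡ countᵇ q xs
countᵇ-cong {p = p} {q} p≗q xs =
  cong length (filter-≐ (T? ∘ p) (T? ∘ q) ((λ {x} → subst So (p≗q x)) , (λ {x} → subst So (sym (p≗q x)))) xs)

countᵇ-false : ∀ {A : Set} (xs : List A) → countᵇ (λ _ → false) xs ≡ 0
countᵇ-false []       = refl
countᵇ-false (_ ∷ xs) = countᵇ-false xs

countᵇ-++ : ∀ {A : Set} (p : A → Bool) xs ys → countᵇ p (xs ++ ys) ≡ countᵇ p xs + countᵇ p ys
countᵇ-++ p xs ys = trans (cong length (filter-++ (T? ∘ p) xs ys)) (length-++ (filterᵇ p xs))

countᵇ-map : ∀ {A B : Set} (p : B → Bool) (f : A → B) xs → countᵇ p (map f xs) ≡ countᵇ (p ∘ f) xs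
countᵇ-map p f []       = refl
countᵇ-map p f (x ∷ xs) with p (f x)
... | true  = cong suc (countᵇ-map p f xs)
... | false = countᵇ-map p f xs

countᵇ-tabulate : ∀ {A : Set} {n} (p : A → Bool) (f : Fin n → A) → countᵇ p (tabulate f) ≡ ∑ (indicator ∘ p ∘ f)
countᵇ-tabulate {n = zero}  p f = refl
countᵇ-tabulate {n = suc n} p f with p (f zero)
... | true  = cong suc (countᵇ-tabulate p (f ∘ suc))
... | false = countᵇ-tabulate p (f ∘ suc)

countᵇ-allFin : ∀ {n} (p : Fin n → Bool) → countᵇ p (allFin n) ≡ ∑ (indicator ∘ p)
countᵇ-allFin p = countᵇ-tabulate p id

sum-tabulate : ∀ {n} (f : Fin n → ℕ) → sum (tabulate f) ≡ ∑ f
sum-tabulate {zero}  f = refl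
sum-tabulate {suc n} f = cong (f zero +_) (sum-tabulate (f ∘ suc))

sum-map-allFin : ∀ {n} (f : Fin n → ℕ) → sum (map f (allFin n)) ≡ ∑ f
sum-map-allFin f = trans (cong sum (map-tabulate id f)) (sum-tabulate f)

countᵇ-allVecs-suc : ∀ a k (p : Vec (Fin a) (suc k) → Bool) →
                     countᵇ p (allVecs a (suc k)) ≡ ∑[ y < a ] countᵇ (p ∘ (y ∷_)) (allVecs a k)
countᵇ-allVecs-suc a k p = begin
  countᵇ p (concatMap (λ y → map (y ∷_) (allVecs a k)) (allFin a))
    ≡⟨ countᵇ-concatMap (allFin a) ⟩
  sum (map (λ y → countᵇ p (map (y ∷_) (allVecs a k))) (allFin a))
    ≡⟨ cong sum (map-cong (λ y → countᵇ-map p (y ∷_) (allVecs a k)) (allFin a)) ⟩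
  sum (map (λ y → countᵇ (p ∘ (y ∷_)) (allVecs a k)) (allFin a))
    ≡⟨ sum-map-allFin (λ y → countᵇ (p ∘ (y ∷_)) (allVecs a k)) ⟩
  ∑[ y < a ] countᵇ (p ∘ (y ∷_)) (allVecs a k)
    ∎
  where
  countᵇ-concatMap : ∀ {A : Set} {g : A → List (Vec (Fin a) (suc k))} xs →
                     countᵇ p (concatMap g xs) ≡ sum (map (countᵇ p ∘ g) xs)
  countᵇ-concatMap         []       = refl
  countᵇ-concatMap {g = g} (x ∷ xs) = trans (countᵇ-++ p (g x) _) (cong (countᵇ p (g x) +_) (countᵇ-concatMap xs))

countᵇ-≤-length : ∀ {A : Set} (p : A → Bool) xs → countᵇ p xs ≤ length xs
countᵇ-≤-length p = length-filter (T? ∘ p)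

fresh : ∀ {a k} → Fin a → Vec (Fin a) k → Bool
fresh x []      = true
fresh x (y ∷ r) = not (does (y ≟ x)) ∧ fresh x r

distinct : ∀ {a k} → Vec (Fin a) k → Bool
distinct []      = true
distinct (y ∷ r) = fresh y r ∧ distinct r

fresh⁺ : ∀ {a k} {x : Fin a} (r : Vec (Fin a) k) → So (fresh x r) → ∀ i → lookup r i ≢ x
fresh⁺ {x = x} (y ∷ r) h zero y≡x with y ≟ x | h
... | no y≢x | _ = y≢x y≡x
fresh⁺ (y ∷ r) h (suc i) = fresh⁺ r (proj₂ (to T-∧ h)) i

fresh⁻ : ∀ {a k} {x : Fin a} (r : Vec (Fin a) k) → (∀ i → lookup r i ≢ x) → So (fresh x r)
fresh⁻          []      _   = _
fresh⁻ {x = x} (y ∷ r) r≢x = from T-∧ (y-fresh , fresh⁻ r (r≢x ∘ suc))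
  where
  y-fresh : So (not (does (y ≟ x)))
  y-fresh rewrite dec-false (y ≟ x) (r≢x zero) = _

distinct⁺ : ∀ {a k} (v : Vec (Fin a) k) → So (distinct v) → Injective _≡_ _≡_ (lookup v)
distinct⁺ (y ∷ r) h {zero}  {zero}  _  = refl
distinct⁺ (y ∷ r) h {zero}  {suc j} eq = ⊥-elim (fresh⁺ r (proj₁ (to T-∧ h)) j (sym eq))
distinct⁺ (y ∷ r) h {suc i} {zero}  eq = ⊥-elim (fresh⁺ r (proj₁ (to T-∧ h)) i eq)
distinct⁺ (y ∷ r) h {suc i} {suc j} eq = cong suc (distinct⁺ r (proj₂ (to T-∧ h)) eq)

distinct⁻ : ∀ {a k} (v : Vec (Fin a) k) → Injective _≡_ _≡_ (lookup v) → So (distinct v)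
distinct⁻ []      _     = _
distinct⁻ (y ∷ r) v-inj = from T-∧ (fresh⁻ r (λ i eq → 0≢1+n (sym (v-inj eq))) , distinct⁻ r (suc-injective ∘ v-inj))

-- e hits every value but x, since punchOut ∘ e is an injective, hence bijective, endomap of Fin m.
countᵇ-fresh : ∀ {m} k (x : Fin (suc m)) (e : Fin m → Fin (suc m)) → Injective _≡_ _≡_ e → (∀ z → e z ≢ x) →
               (p : Vec (Fin (suc m)) k → Bool) →
               countᵇ (λ r → fresh x r ∧ p r) (allVecs (suc m) k) ≡ countᵇ (p ∘ Vec.map e) (allVecs m k)
countᵇ-fresh zero    x e e-inj e≢x p with p []
... | true  = refl
... | false = refl
countᵇ-fresh {m} (suc k) x e e-inj e≢x p = begin
  countᵇ (λ r → fresh x r ∧ p r) (allVecs (suc m) (suc k))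
    ≡⟨ countᵇ-allVecs-suc (suc m) k _ ⟩
  ∑ h
    ≡⟨ sum-remove {i = x} h ⟩
  h x + ∑ (h ∘ punchIn x)
    ≡⟨ cong₂ _+_ hx≡0 (sum-cong-≗ h≡g) ⟩
  0 + ∑ (g ∘ punchIn x)
    ≡⟨ sym (∑-reindex τ τ-inj (g ∘ punchIn x)) ⟩
  ∑ (g ∘ punchIn x ∘ τ)
    ≡⟨ sum-cong-≗ (λ z → cong g (punchIn-punchOut (x≢e z))) ⟩
  ∑ (g ∘ e)
    ≡⟨ sym (countᵇ-allVecs-suc m k _) ⟩
  countᵇ (p ∘ Vec.map e) (allVecs m (suc k))
    ∎
  where
  h g : Fin (suc m) → ℕ
  h y = countᵇ (λ r → (not (does (y ≟ x)) ∧ fresh x r) ∧ p (y ∷ r)) (allVecs (suc m) k)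
  g y = countᵇ (λ σ → p (y ∷ Vec.map e σ)) (allVecs m k)
  hx≡0 : h x ≡ 0
  hx≡0 rewrite dec-true (x ≟ x) refl = countᵇ-false (allVecs (suc m) k)
  h≡g : ∀ w → h (punchIn x w) ≡ g (punchIn x w)
  h≡g w rewrite dec-false (punchIn x w ≟ x) (punchInᵢ≢i x w) = countᵇ-fresh k x e e-inj e≢x (p ∘ (punchIn x w ∷_))
  x≢e : ∀ z → x ≢ e z
  x≢e z = e≢x z ∘ sym
  τ : Fin m → Fin m
  τ z = punchOut (x≢e z)
  τ-inj : Injective _≡_ _≡_ τ
  τ-inj eq = e-inj (punchOut-injective (x≢e _) (x≢e _) eq)

-- The Boolean definitions as propositions

So-all-allFin⁺ : ∀ {n} (p : Fin n → Bool) → So (all p (allFin n)) → ∀ i → So (p i)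
So-all-allFin⁺ {n} p h i = All.lookup (all⁺ p (allFin n) h) (∈-allFin i)

So-all-allFin⁻ : ∀ {n} (p : Fin n → Bool) → (∀ i → So (p i)) → So (all p (allFin n))
So-all-allFin⁻ {n} p h = all⁻ p {xs = allFin n} (All.tabulate (λ {i} _ → h i))

So-all-allFin-¬ : ∀ {n} (p : Fin n → Bool) → ¬ So (all p (allFin n)) → ∃ λ i → ¬ So (p i)
So-all-allFin-¬ {n} p ¬all = satisfied (¬All⇒Any¬ (T? ∘ p) (allFin n) (¬all ∘ all⁻ p))

So-any-allFin⁺ : ∀ {n} (p : Fin n → Bool) → So (any p (allFin n)) → ∃ λ i → So (p i)
So-any-allFin⁺ {n} p h = satisfied (any⁻ p (allFin n) h)

So-any-allFin⁻ : ∀ {n} (p : Fin n → Bool) i → So (p i) → So (any p (allFin n))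
So-any-allFin⁻ p i h = any⁺ p (lose (∈-allFin i) h)

IsPermutation : ∀ {n} → Word n → Set
IsPermutation π = Injective _≡_ _≡_ (lookup π)

isPerm-no-equal-pair : ∀ {n} (π : Word n) → So (isPerm π) → ∀ {i j} → toℕ i < toℕ j → val π i ≢ val π j
isPerm-no-equal-pair π h {i} {j} i<j vi≡vj with So-all-allFin⁺ _ (So-all-allFin⁺ _ h i) j
-- hij is the entry of isPerm π at (i, j); the rewrites turn its type into So (false ∨ false).
... | hij rewrite to T-≡ (<⇒<ᵇ i<j) | to T-≡ (≡⇒≡ᵇ _ _ vi≡vj) = hij

isPerm⁺ : ∀ {n} (π : Word n) → So (isPerm π) → IsPermutation π
isPerm⁺ π h {i} {j} eq with <-cmp (toℕ i) (toℕ j)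
... | tri< i<j _ _ = ⊥-elim (isPerm-no-equal-pair π h i<j (cong toℕ eq))
... | tri≈ _ i≡j _ = toℕ-injective i≡j
... | tri> _ _ j<i = ⊥-elim (isPerm-no-equal-pair π h j<i (cong toℕ (sym eq)))

isPerm⁻ : ∀ {n} (π : Word n) → IsPermutation π → So (isPerm π)
isPerm⁻ π π-inj with T? (isPerm π)
... | yes h = h
... | no ¬h with So-all-allFin-¬ _ ¬h
...   | i , ¬hi with So-all-allFin-¬ _ ¬hi
...     | j , ¬hij with toℕ i <ᵇ toℕ j in i<ᵇj | val π i ≡ᵇ val π j in vi≡ᵇvj | ¬hij
...       | false | _     | ¬ok = ⊥-elim (¬ok _)
...       | true  | false | ¬ok = ⊥-elim (¬ok _)
...       | true  | true  | _   = ⊥-elim (<-irrefl (cong toℕ (π-inj vi≡vj)) (<ᵇ⇒< _ _ (from T-≡ i<ᵇj)))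
  where
  vi≡vj : lookup π i ≡ lookup π j
  vi≡vj = toℕ-injective (≡ᵇ⇒≡ _ _ (from T-≡ vi≡ᵇvj))

isPerm⇔distinct : ∀ {n} (π : Word n) → So (isPerm π) ⇔ So (distinct π)
isPerm⇔distinct π = mk⇔ (distinct⁻ π ∘ isPerm⁺ π) (isPerm⁻ π ∘ distinct⁺ π)

data Contains321 {n} (π : Word n) : Set where
  occurrence : ∀ i j k → toℕ i < toℕ j → toℕ j < toℕ k → val π j < val π i → val π k < val π j → Contains321 π

contains321⁺ : ∀ {n} (π : Word n) → So (contains321 π) → Contains321 π
contains321⁺ π h =
  let i , hi = So-any-allFin⁺ _ h
      j , hj = So-any-allFin⁺ _ hi
      k , hk = So-any-allFin⁺ _ hj
      i<j , hk₁ = to T-∧ hk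
      j<k , hk₂ = to T-∧ hk₁
      πj<πi , πk<πj = to T-∧ hk₂
  in occurrence i j k (<ᵇ⇒< _ _ i<j) (<ᵇ⇒< _ _ j<k) (<ᵇ⇒< _ _ πj<πi) (<ᵇ⇒< _ _ πk<πj)

contains321⁻ : ∀ {n} (π : Word n) → Contains321 π → So (contains321 π)
contains321⁻ π (occurrence i j k i<j j<k πj<πi πk<πj) =
  So-any-allFin⁻ _ i (So-any-allFin⁻ _ j (So-any-allFin⁻ _ k
    (from T-∧ (<⇒<ᵇ i<j , from T-∧ (<⇒<ᵇ j<k , from T-∧ (<⇒<ᵇ πj<πi , <⇒<ᵇ πk<πj))))))

avoids321⇔ : ∀ {n} (π : Word n) → So (avoids321 π) ⇔ (¬ Contains321 π)
avoids321⇔ π = mk⇔ (λ h → So-not⁺ h ∘ contains321⁻ π) (λ ¬c → So-not⁻ (¬c ∘ contains321⁺ π))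

shallow⇔ : ∀ {n} (π : Word n) → So (shallow π) ⇔ (I π + T π ≡ D π)
shallow⇔ π = mk⇔ (≡ᵇ⇒≡ _ _) (≡⇒≡ᵇ _ _)

displacement : ∀ {n} → (Fin n → ℕ) → ℕ
displacement {n} v = ∑[ i < n ] ∣ v i - toℕ i ∣

inversionsFrom : ∀ {n} → (Fin n → ℕ) → Fin n → ℕ
inversionsFrom {n} v i = ∑[ j < n ] indicator ((toℕ i <ᵇ toℕ j) ∧ (v j <ᵇ v i))

inversions : ∀ {n} → (Fin n → ℕ) → ℕ
inversions v = ∑ (inversionsFrom v)

D≡displacement : ∀ {n} (π : Word n) → D π ≡ displacement (val π)
D≡displacement {n} π = sum-map-allFin {n} _

I≡inversions : ∀ {n} (π : Word n) → I π ≡ inversions (val π)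
I≡inversions {n} π = trans (cong sum (map-cong (λ i → countᵇ-allFin {n} _) (allFin n))) (sum-map-allFin {n} _)

cyc≡∑ : ∀ {n} (π : Word n) → cyc π ≡ ∑ (indicator ∘ isCycleMin π)
cyc≡∑ π = countᵇ-allFin (isCycleMin π)

cyc≤n : ∀ {n} (π : Word n) → cyc π ≤ n
cyc≤n {n} π = ≤-trans (countᵇ-≤-length (isCycleMin π) (allFin n)) (≤-reflexive (length-tabulate id))

-- Orbits and cycle minima

iter-+ : ∀ {n} (π : Word n) a b i → iter π (a + b) i ≡ iter π a (iter π b i)
iter-+ π zero    b i = refl
iter-+ π (suc a) b i = cong (lookup π) (iter-+ π a b i)

iter-injective : ∀ {n} {π : Word n} → IsPermutation π → ∀ t → Injective _≡_ _≡_ (iter π t)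
iter-injective π-perm zero    eq = eq
iter-injective π-perm (suc t) eq = iter-injective π-perm t (π-perm eq)

record Period {n} (π : Word n) (i : Fin n) : Set where
  field
    p       : ℕ
    1≤p     : 1 ≤ p
    p≤n     : p ≤ n
    returns : iter π p i ≡ i

period : ∀ {n} (π : Word n) → IsPermutation π → ∀ i → Period π i
period {n} π π-perm i with pigeonhole (≤-refl {suc n}) (λ a → iter π (toℕ a) i)
... | a , b , a<b , πᵃi≡πᵇi = record
  { p = toℕ b ∸ toℕ a
  ; 1≤p = m<n⇒0<n∸m a<b
  ; p≤n = ≤-trans (m∸n≤m (toℕ b) (toℕ a)) (s≤s⁻¹ (toℕ<n b))
  ; returns = iter-injective π-perm (toℕ a) (begin
      iter π (toℕ a) (iter π (toℕ b ∸ toℕ a) i)  ≡⟨ iter-+ π (toℕ a) _ i ⟨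
      iter π (toℕ a + (toℕ b ∸ toℕ a)) i         ≡⟨ cong (λ t → iter π t i) (m+[n∸m]≡n (<⇒≤ a<b)) ⟩
      iter π (toℕ b) i                           ≡⟨ πᵃi≡πᵇi ⟨
      iter π (toℕ a) i                           ∎)
  }

within-period : ∀ {n} {π : Word n} {i} (P : Period π i) → ∀ t → ∃ λ r → r < Period.p P × iter π t i ≡ iter π r i
within-period P zero = 0 , Period.1≤p P , refl
within-period {π = π} {i} P (suc t) with within-period P t
... | r , r<p , πᵗi≡πʳi with m≤n⇒m<n∨m≡n r<p
...   | inj₁ 1+r<p  = suc r , 1+r<p , cong (lookup π) πᵗi≡πʳi
...   | inj₂ 1+r≡p = 0 , Period.1≤p P ,
  trans (cong (lookup π) πᵗi≡πʳi) (trans (cong (λ t → iter π t i) 1+r≡p) (Period.returns P))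

preimage : ∀ {n} (π : Word n) → IsPermutation π → ∀ c → ∃ λ k → lookup π k ≡ c
preimage π π-perm c with period π π-perm c
... | record { p = suc p ; returns = returns } = iter π p c , returns

CycleMin : ∀ {n} → Word n → Fin n → Set
CycleMin π x = ∀ t → toℕ x ≤ toℕ (iter π t x)

isCycleMin⁻ : ∀ {n} (π : Word n) x → CycleMin π x → So (isCycleMin π x)
isCycleMin⁻ {n} π x x-min =
  So-all-allFin⁻ {n} _ (λ k → So-not⁻ (λ lt → <⇒≱ (<ᵇ⇒< _ _ lt) (x-min (suc (toℕ k)))))

isCycleMin⁺ : ∀ {n} (π : Word n) → IsPermutation π → ∀ x → So (isCycleMin π x) → CycleMin π x
isCycleMin⁺ {n} π π-perm x h t with within-period (period π π-perm x) t
... | zero  , _   , πᵗx≡x    rewrite πᵗx≡x    = ≤-refl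
... | suc r , r<p , πᵗx≡πʳ⁺¹x rewrite πᵗx≡πʳ⁺¹x = ≮⇒≥ (λ lt → So-not⁺ (So-all-allFin⁺ _ h (fromℕ< r<n))
      (subst (λ s → So (toℕ (iter π (suc s) x) <ᵇ toℕ x)) (sym (toℕ-fromℕ< r<n)) (<⇒<ᵇ lt)))
  where
  r<n : r < n
  r<n = <-≤-trans (<-trans (n<1+n r) r<p) (Period.p≤n (period π π-perm x))

Reaches : ∀ {n} → Word n → Fin n → Fin n → Set
Reaches π x y = ∃ λ t → iter π t x ≡ y

reaches-trans : ∀ {n} (π : Word n) {x y z} → Reaches π x y → Reaches π y z → Reaches π x z
reaches-trans π {x} (a , πᵃx≡y) (b , πᵇy≡z) =
  b + a , trans (iter-+ π b a x) (trans (cong (iter π b) πᵃx≡y) πᵇy≡z)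

reaches-sym : ∀ {n} (π : Word n) → IsPermutation π → ∀ {x y} → Reaches π x y → Reaches π y x
reaches-sym π π-perm {x} {y} (t , πᵗx≡y) with within-period (period π π-perm x) t
... | r , r<p , πᵗx≡πʳx = p ∸ r , (begin
  iter π (p ∸ r) y               ≡⟨ cong (iter π (p ∸ r)) (trans (sym πᵗx≡y) πᵗx≡πʳx) ⟩
  iter π (p ∸ r) (iter π r x)    ≡⟨ iter-+ π (p ∸ r) r x ⟨
  iter π (p ∸ r + r) x           ≡⟨ cong (λ s → iter π s x) (m∸n+n≡m (<⇒≤ r<p)) ⟩
  iter π p x                     ≡⟨ Period.returns P ⟩
  x                              ∎)
  where
  P : Period π x
  P = period π π-perm x
  p : ℕ
  p = Period.p P

reaches-in-≥1-steps : ∀ {n} (π : Word n) → IsPermutation π → ∀ {x y} → Reaches π x y →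
                      ∃ λ s → iter π (suc s) x ≡ y
reaches-in-≥1-steps π π-perm (suc s , πˢ⁺¹x≡y) = s , πˢ⁺¹x≡y
reaches-in-≥1-steps π π-perm {x} (zero , refl) with period π π-perm x
... | record { p = suc p ; returns = returns } = p , returns

minimum-attained : ∀ {n} (f : Fin (suc n) → ℕ) → ∃ λ r → ∀ r′ → f r ≤ f r′
minimum-attained {zero} f = zero , λ { zero → ≤-refl }
minimum-attained {suc n} f with minimum-attained (f ∘ suc)
... | r , fr≤ with f zero ≤? f (suc r)
...   | yes f0≤fr = zero , λ { zero → ≤-refl ; (suc r′) → ≤-trans f0≤fr (fr≤ r′) }
...   | no  f0≰fr = suc r , λ { zero → <⇒≤ (≰⇒> f0≰fr) ; (suc r′) → fr≤ r′ }

orbit-minimum : ∀ {n} (π : Word n) → IsPermutation π → ∀ c →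
                ∃ λ x₀ → Reaches π c x₀ × (∀ t → toℕ x₀ ≤ toℕ (iter π t c))
orbit-minimum {suc n} π π-perm c with minimum-attained (λ r → toℕ (iter π (toℕ r) c))
... | r₀ , min = iter π (toℕ r₀) c , (toℕ r₀ , refl) , below
  where
  P : Period π c
  P = period π π-perm c
  below : ∀ t → toℕ (iter π (toℕ r₀) c) ≤ toℕ (iter π t c)
  below t with within-period P t
  ... | r , r<p , πᵗc≡πʳc rewrite πᵗc≡πʳc =
    subst (λ s → toℕ (iter π (toℕ r₀) c) ≤ toℕ (iter π s c)) (toℕ-fromℕ< r<1+n) (min (fromℕ< r<1+n))
    where
    r<1+n : r < suc n
    r<1+n = <-≤-trans r<p (Period.p≤n P)

-- Building a permutation from its first entry

-- prepend x σ is the permutation (0 x) ∘ (1 ⊕ σ): it starts with x, and the rest is σ shifted up by one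
-- except that the entry that would become x becomes 0.
relabel : ∀ {m} → Fin (suc m) → Fin m → Fin (suc m)
relabel zero    y = suc y
relabel (suc c) y = if does (y ≟ c) then zero else suc y

prepend : ∀ {m} → Fin (suc m) → Word m → Word (suc m)
prepend x σ = x ∷ Vec.map (relabel x) σ

relabel-self : ∀ {m} (c : Fin m) → relabel (suc c) c ≡ zero
relabel-self c rewrite dec-true (c ≟ c) refl = refl

relabel-other : ∀ {m} {c y : Fin m} → y ≢ c → relabel (suc c) y ≡ suc y
relabel-other {c = c} {y} y≢c rewrite dec-false (y ≟ c) y≢c = refl

relabel-injective : ∀ {m} (x : Fin (suc m)) → Injective _≡_ _≡_ (relabel x)
relabel-injective zero    refl = refl
relabel-injective (suc c) {y} {z} eq with y ≟ c | z ≟ c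
... | yes y≡c | yes z≡c = trans y≡c (sym z≡c)
... | no  _   | no  _   = suc-injective eq

relabel-≢ : ∀ {m} (x : Fin (suc m)) y → relabel x y ≢ x
relabel-≢ (suc c) y eq with y ≟ c
relabel-≢ (suc c) y () | yes _
relabel-≢ (suc c) y eq | no y≢c = y≢c (suc-injective eq)

lookup-prepend : ∀ {m} (x : Fin (suc m)) (σ : Word m) i → lookup (prepend x σ) (suc i) ≡ relabel x (lookup σ i)
lookup-prepend x σ i = lookup-map i (relabel x) σ

prepend-perm : ∀ {m} (x : Fin (suc m)) {σ : Word m} → IsPermutation σ → IsPermutation (prepend x σ)
prepend-perm x         σ-perm {zero}  {zero}  _  = refl
prepend-perm x {σ}     σ-perm {zero}  {suc j} eq = ⊥-elim (relabel-≢ x (lookup σ j) (sym (trans eq (lookup-prepend x σ j))))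
prepend-perm x {σ}     σ-perm {suc i} {zero}  eq = ⊥-elim (relabel-≢ x (lookup σ i) (trans (sym (lookup-prepend x σ i)) eq))
prepend-perm x {σ}     σ-perm {suc i} {suc j} eq =
  cong suc (σ-perm (relabel-injective x (trans (sym (lookup-prepend x σ i)) (trans eq (lookup-prepend x σ j)))))

unrelabel : ∀ {m} (x y : Fin (suc m)) → y ≢ x → Fin m
unrelabel zero    zero    y≢x = ⊥-elim (y≢x refl)
unrelabel zero    (suc y) _   = y
unrelabel (suc c) zero    _   = c
unrelabel (suc c) (suc y) _   = y

relabel-unrelabel : ∀ {m} (x y : Fin (suc m)) (y≢x : y ≢ x) → relabel x (unrelabel x y y≢x) ≡ y
relabel-unrelabel zero    zero    y≢x = ⊥-elim (y≢x refl)
relabel-unrelabel zero    (suc y) _   = refl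
relabel-unrelabel (suc c) zero    _   = relabel-self c
relabel-unrelabel (suc c) (suc y) y≢x = relabel-other (y≢x ∘ cong suc)

prepend-surjective : ∀ {m} (π : Word (suc m)) → IsPermutation π →
                     ∃ λ x → ∃ λ σ → π ≡ prepend x σ × IsPermutation σ
prepend-surjective {m} (x ∷ r) π-perm = x , σ , cong (x ∷_) (sym map-relabel-σ) , σ-perm
  where
  r≢x : ∀ i → lookup r i ≢ x
  r≢x i eq with () ← π-perm {suc i} {zero} eq
  σ : Word m
  σ = Vec.tabulate (λ i → unrelabel x (lookup r i) (r≢x i))
  relabel-σ : ∀ i → relabel x (lookup σ i) ≡ lookup r i
  relabel-σ i = trans (cong (relabel x) (lookup∘tabulate _ i)) (relabel-unrelabel x _ (r≢x i))
  map-relabel-σ : Vec.map (relabel x) σ ≡ r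
  map-relabel-σ = trans (sym (tabulate-∘ (relabel x) _))
                        (trans (tabulate-cong (λ i → relabel-unrelabel x _ (r≢x i))) (tabulate∘lookup r))
  σ-perm : IsPermutation σ
  σ-perm {i} {j} eq =
    suc-injective (π-perm {suc i} {suc j} (trans (sym (relabel-σ i)) (trans (cong (relabel x) eq) (relabel-σ j))))

val-prepend-zero : ∀ {m} (σ : Word m) i → val (prepend zero σ) (suc i) ≡ suc (val σ i)
val-prepend-zero σ i = cong toℕ (lookup-prepend zero σ i)

D-prepend-zero : ∀ {m} (σ : Word m) → D (prepend zero σ) ≡ D σ
D-prepend-zero σ = begin
  D (prepend zero σ)
    ≡⟨ D≡displacement (prepend zero σ) ⟩
  displacement (val (prepend zero σ))
    ≡⟨ sum-cong-≗ (λ i → cong (λ v → ∣ v - suc (toℕ i) ∣) (val-prepend-zero σ i)) ⟩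
  displacement (val σ)
    ≡⟨ D≡displacement σ ⟨
  D σ
    ∎

I-prepend-zero : ∀ {m} (σ : Word m) → I (prepend zero σ) ≡ I σ
I-prepend-zero {m} σ = begin
  I (prepend zero σ)
    ≡⟨ I≡inversions (prepend zero σ) ⟩
  inversions (val (prepend zero σ))
    ≡⟨ cong₂ _+_ (∑-zero {m} (λ _ → refl)) (sum-cong-≗ (λ i → sum-cong-≗ (λ j → shift i j))) ⟩
  inversions (val σ)
    ≡⟨ I≡inversions σ ⟨
  I σ
    ∎
  where
  shift : ∀ i j → indicator ((toℕ i <ᵇ toℕ j) ∧ (val (prepend zero σ) (suc j) <ᵇ val (prepend zero σ) (suc i)))
                ≡ indicator ((toℕ i <ᵇ toℕ j) ∧ (val σ j <ᵇ val σ i))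
  shift i j = cong₂ (λ vj vi → indicator ((toℕ i <ᵇ toℕ j) ∧ (vj <ᵇ vi))) (val-prepend-zero σ j) (val-prepend-zero σ i)

iter-prepend-zero : ∀ {m} (σ : Word m) t x → iter (prepend zero σ) t (suc x) ≡ suc (iter σ t x)
iter-prepend-zero σ zero    x = refl
iter-prepend-zero σ (suc t) x =
  trans (cong (lookup (prepend zero σ)) (iter-prepend-zero σ t x)) (lookup-prepend zero σ _)

isCycleMin-zero : ∀ {m} (π : Word (suc m)) → So (isCycleMin π zero)
isCycleMin-zero π = isCycleMin⁻ π zero (λ _ → z≤n)

cyc-prepend-zero : ∀ {m} (σ : Word m) → IsPermutation σ → cyc (prepend zero σ) ≡ suc (cyc σ)
cyc-prepend-zero {m} σ σ-perm = begin
  cyc π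
    ≡⟨ cyc≡∑ π ⟩
  indicator (isCycleMin π zero) + ∑ (indicator ∘ isCycleMin π ∘ suc)
    ≡⟨ cong₂ _+_ (cong indicator (to T-≡ (isCycleMin-zero π))) (sum-cong-≗ (cong indicator ∘ same-minima)) ⟩
  suc (∑ (indicator ∘ isCycleMin σ))
    ≡⟨ cong suc (cyc≡∑ σ) ⟨
  suc (cyc σ)
    ∎
  where
  π : Word (suc m)
  π = prepend zero σ
  same-minima : ∀ x → isCycleMin π (suc x) ≡ isCycleMin σ x
  same-minima x = So-ext (mk⇔
    (λ h → isCycleMin⁻ σ x (λ t → s≤s⁻¹ (subst (above x) (iter-prepend-zero σ t x)
                                                  (isCycleMin⁺ π (prepend-perm zero σ-perm) (suc x) h t))))
    (λ h → isCycleMin⁻ π (suc x) (λ t → subst (above x) (sym (iter-prepend-zero σ t x))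
                                                  (s≤s (isCycleMin⁺ σ σ-perm x h t)))))
    where
    above : Fin m → Fin (suc m) → Set
    above x y = suc (toℕ x) ≤ toℕ y

contains321-prepend-zero⁺ : ∀ {m} (σ : Word m) → Contains321 (prepend zero σ) → Contains321 σ
contains321-prepend-zero⁺ σ (occurrence zero    j       k       _ _ () _)
contains321-prepend-zero⁺ σ (occurrence (suc i) zero    k       () _ _ _)
contains321-prepend-zero⁺ σ (occurrence (suc i) (suc j) zero    _ () _ _)
contains321-prepend-zero⁺ σ (occurrence (suc i) (suc j) (suc k) i<j j<k πj<πi πk<πj) =
  occurrence i j k (s≤s⁻¹ i<j) (s≤s⁻¹ j<k)
    (s≤s⁻¹ (subst₂ _<_ (val-prepend-zero σ j) (val-prepend-zero σ i) πj<πi))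
    (s≤s⁻¹ (subst₂ _<_ (val-prepend-zero σ k) (val-prepend-zero σ j) πk<πj))

contains321-prepend-zero⁻ : ∀ {m} (σ : Word m) → Contains321 σ → Contains321 (prepend zero σ)
contains321-prepend-zero⁻ σ (occurrence i j k i<j j<k σj<σi σk<σj) =
  occurrence (suc i) (suc j) (suc k) (s≤s i<j) (s≤s j<k)
    (subst₂ _<_ (sym (val-prepend-zero σ j)) (sym (val-prepend-zero σ i)) (s≤s σj<σi))
    (subst₂ _<_ (sym (val-prepend-zero σ k)) (sym (val-prepend-zero σ j)) (s≤s σk<σj))

avoids321-prepend-zero : ∀ {m} (σ : Word m) → avoids321 (prepend zero σ) ≡ avoids321 σ
avoids321-prepend-zero σ = So-ext (mk⇔
  (λ h → from (avoids321⇔ σ) (to (avoids321⇔ (prepend zero σ)) h ∘ contains321-prepend-zero⁻ σ))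
  (λ h → from (avoids321⇔ (prepend zero σ)) (to (avoids321⇔ σ) h ∘ contains321-prepend-zero⁺ σ)))

∣-∣+⊓+⊓ : ∀ a b → ∣ a - b ∣ + (a ⊓ b + a ⊓ b) ≡ a + b
∣-∣+⊓+⊓ zero    b       = +-identityʳ b
∣-∣+⊓+⊓ (suc a) zero    = refl
∣-∣+⊓+⊓ (suc a) (suc b) = begin
  ∣ a - b ∣ + (suc (a ⊓ b) + suc (a ⊓ b))   ≡⟨ shift-sucs ∣ a - b ∣ (a ⊓ b) ⟩
  suc (suc (∣ a - b ∣ + (a ⊓ b + a ⊓ b)))   ≡⟨ cong (λ x → suc (suc x)) (∣-∣+⊓+⊓ a b) ⟩
  suc (suc (a + b))                         ≡⟨ cong suc (+-suc a b) ⟨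
  suc a + suc b                             ∎
  where
  shift-sucs : ∀ d e → d + (suc e + suc e) ≡ suc (suc (d + (e + e)))
  shift-sucs = solve-∀

module PrependSuc {m} (σ : Word m) (σ-perm : IsPermutation σ) (c : Fin m) where

  π : Word (suc m)
  π = prepend (suc c) σ

  k : Fin m
  k = proj₁ (preimage σ σ-perm c)

  σk≡c : lookup σ k ≡ c
  σk≡c = proj₂ (preimage σ σ-perm c)

  c′ k′ : ℕ
  c′ = toℕ c
  k′ = toℕ k

  v w : Fin m → ℕ
  v   = val σ
  w i = val π (suc i)

  v-k : v k ≡ c′
  v-k = cong toℕ σk≡c

  w-k : w k ≡ 0
  w-k = cong toℕ (trans (lookup-prepend (suc c) σ k) (trans (cong (relabel (suc c)) σk≡c) (relabel-self c)))

  σ-other : ∀ {i} → i ≢ k → lookup σ i ≢ c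
  σ-other i≢k σi≡c = i≢k (σ-perm (trans σi≡c (sym σk≡c)))

  w-other : ∀ {i} → i ≢ k → w i ≡ suc (v i)
  w-other i≢k = cong toℕ (trans (lookup-prepend (suc c) σ _) (relabel-other (σ-other i≢k)))

  M : ℕ
  M = c′ ⊓ k′

  displacement-prepend : displacement (val π) + ∣ c′ - k′ ∣ ≡ suc c′ + (displacement v + suc k′)
  displacement-prepend = begin
    suc c′ + ∑ f + ∣ c′ - k′ ∣     ≡⟨ cong (λ x → suc c′ + ∑ f + ∣ x - k′ ∣) v-k ⟨
    suc c′ + ∑ f + g k             ≡⟨ +-assoc (suc c′) (∑ f) (g k) ⟩
    suc c′ + (∑ f + g k)           ≡⟨ cong (suc c′ +_) (∑-agree-except k f≡g) ⟩
    suc c′ + (∑ g + f k)           ≡⟨ cong (λ x → suc c′ + (∑ g + ∣ x - suc k′ ∣)) w-k ⟩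
    suc c′ + (displacement v + suc k′) ∎
    where
    f g : Fin m → ℕ
    f i = ∣ w i - suc (toℕ i) ∣
    g i = ∣ v i - toℕ i ∣
    f≡g : ∀ i → i ≢ k → f i ≡ g i
    f≡g i i≢k = cong (λ x → ∣ x - suc (toℕ i) ∣) (w-other i≢k)

  D-prepend-suc : D π ≡ suc (suc (D σ + (M + M)))
  D-prepend-suc = +-cancelʳ-≡ ∣ c′ - k′ ∣ _ _ (begin
    D π + ∣ c′ - k′ ∣
      ≡⟨ cong (_+ ∣ c′ - k′ ∣) (D≡displacement π) ⟩
    displacement (val π) + ∣ c′ - k′ ∣
      ≡⟨ displacement-prepend ⟩
    suc c′ + (displacement v + suc k′)
      ≡⟨ cong (λ d → suc c′ + (d + suc k′)) (D≡displacement σ) ⟨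
    suc c′ + (D σ + suc k′)
      ≡⟨ regroup c′ (D σ) k′ ⟩
    suc (suc (D σ + (c′ + k′)))
      ≡⟨ cong (λ x → suc (suc (D σ + x))) (∣-∣+⊓+⊓ c′ k′) ⟨
    suc (suc (D σ + (∣ c′ - k′ ∣ + (M + M))))
      ≡⟨ cong (λ x → suc (suc x)) (swap-last (D σ) ∣ c′ - k′ ∣ (M + M)) ⟩
    suc (suc (D σ + (M + M))) + ∣ c′ - k′ ∣
      ∎)
    where
    regroup : ∀ a d b → suc a + (d + suc b) ≡ suc (suc (d + (a + b)))
    regroup = solve-∀
    swap-last : ∀ d a b → d + (a + b) ≡ d + b + a
    swap-last = solve-∀

  smallerBefore largerBefore smallerAfter : ℕ
  smallerBefore = ∑[ i < m ] indicator ((toℕ i <ᵇ k′) ∧ (v i <ᵇ v k))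
  largerBefore  = ∑[ i < m ] indicator ((toℕ i <ᵇ k′) ∧ (v k <ᵇ v i))
  smallerAfter  = inversionsFrom v k

  #below-c : ∑[ j < m ] indicator (v j <ᵇ c′) ≡ c′
  #below-c = trans (∑-reindex (lookup σ) σ-perm (λ y → indicator (toℕ y <ᵇ c′)))
                   (∑-indicator-< c′ (<⇒≤ (toℕ<n c)))

  #below-k : ∑[ i < m ] indicator (toℕ i <ᵇ k′) ≡ k′
  #below-k = ∑-indicator-< k′ (<⇒≤ (toℕ<n k))

  #below-head : ∑[ j < m ] indicator (w j <ᵇ suc c′) ≡ suc c′
  #below-head = begin
    ∑ f
      ≡⟨ +-identityʳ (∑ f) ⟨
    ∑ f + 0
      ≡⟨ cong (∑ f +_) (trans (cong (λ x → indicator (x <ᵇ c′)) v-k) (cong indicator (<ᵇ-false (<-irrefl {c′} refl)))) ⟨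
    ∑ f + g k
      ≡⟨ ∑-agree-except k f≡g ⟩
    ∑ g + f k
      ≡⟨ cong₂ _+_ #below-c (cong (λ x → indicator (x <ᵇ suc c′)) w-k) ⟩
    c′ + 1
      ≡⟨ +-comm c′ 1 ⟩
    suc c′
      ∎
    where
    f g : Fin m → ℕ
    f j = indicator (w j <ᵇ suc c′)
    g j = indicator (v j <ᵇ c′)
    f≡g : ∀ j → j ≢ k → f j ≡ g j
    f≡g j j≢k = cong (λ x → indicator (x <ᵇ suc c′)) (w-other j≢k)

  before-k : largerBefore + smallerBefore ≡ k′
  before-k = trans (sym (∑-distrib-+ {m} _ _)) (trans (sum-cong-≗ {m} split) #below-k)
    where
    split : ∀ i → indicator ((toℕ i <ᵇ k′) ∧ (v k <ᵇ v i)) + indicator ((toℕ i <ᵇ k′) ∧ (v i <ᵇ v k))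
                ≡ indicator (toℕ i <ᵇ k′)
    split i with toℕ i <ᵇ k′ in i<ᵇk
    ... | false = refl
    ... | true  = indicator-dichotomy λ vi≡vk →
      <-irrefl (cong toℕ (σ-perm (toℕ-injective vi≡vk))) (<ᵇ⇒< _ _ (from T-≡ i<ᵇk))

  smaller-than-c : smallerBefore + smallerAfter ≡ c′
  smaller-than-c = trans (sym (∑-distrib-+ {m} _ _))
                  (trans (sum-cong-≗ {m} split) (trans (sum-cong-≗ (λ j → cong (λ x → indicator (v j <ᵇ x)) v-k)) #below-c))
    where
    split : ∀ j → indicator ((toℕ j <ᵇ k′) ∧ (v j <ᵇ v k)) + indicator ((k′ <ᵇ toℕ j) ∧ (v j <ᵇ v k))
                ≡ indicator (v j <ᵇ v k)
    split j with j ≟ k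
    ... | yes refl rewrite <ᵇ-false (<-irrefl {v k} refl) | <ᵇ-false (<-irrefl {k′} refl) = refl
    ... | no  j≢k  = indicator-split (j≢k ∘ toℕ-injective) (v j <ᵇ v k)

  -- Only pairs involving position k change: below k every entry beats w k = 0, after k none does.
  inversions-tail : inversions w + largerBefore + smallerAfter ≡ inversions v + k′
  inversions-tail = begin
    inversions w + largerBefore + smallerAfter
      ≡⟨ cong₂ _+_ (∑-distrib-+ {m} (inversionsFrom w) _) g-k ⟨
    ∑ f + g k
      ≡⟨ ∑-agree-except k f≡g ⟩
    ∑ g + f k
      ≡⟨ cong₂ _+_ (trans (∑-distrib-+ {m} (inversionsFrom v) _) (cong (inversions v +_) #below-k)) f-k ⟩
    inversions v + k′ + 0
      ≡⟨ +-identityʳ _ ⟩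
    inversions v + k′
      ∎
    where
    f g : Fin m → ℕ
    f i = inversionsFrom w i + indicator ((toℕ i <ᵇ k′) ∧ (v k <ᵇ v i))
    g i = inversionsFrom v i + indicator (toℕ i <ᵇ k′)
    k≮k : (k′ <ᵇ k′) ≡ false
    k≮k = <ᵇ-false (<-irrefl {k′} refl)
    g-k : g k ≡ smallerAfter
    g-k rewrite k≮k = +-identityʳ smallerAfter
    f-k : f k ≡ 0
    f-k rewrite k≮k = trans (+-identityʳ _) (∑-zero λ j →
      trans (cong (λ x → indicator ((k′ <ᵇ toℕ j) ∧ (w j <ᵇ x))) w-k) (cong indicator (∧-zeroʳ (k′ <ᵇ toℕ j))))
    f≡g : ∀ i → i ≢ k → f i ≡ g i
    f≡g i i≢k = trans (∑-agree-except k inner) (cong (inversionsFrom v i +_) at-k)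
      where
      inner : ∀ j → j ≢ k →
              indicator ((toℕ i <ᵇ toℕ j) ∧ (w j <ᵇ w i)) ≡ indicator ((toℕ i <ᵇ toℕ j) ∧ (v j <ᵇ v i))
      inner j j≢k rewrite w-other i≢k | w-other j≢k = refl
      at-k : indicator ((toℕ i <ᵇ k′) ∧ (w k <ᵇ w i)) ≡ indicator (toℕ i <ᵇ k′)
      at-k rewrite w-k | w-other i≢k = cong indicator (∧-identityʳ _)

  inversions-prepend : inversions (val π) ≡ suc (inversions v + (smallerBefore + smallerBefore))
  inversions-prepend = begin
    inversions (val π)
      ≡⟨ cong (_+ inversions w) #below-head ⟩
    suc c′ + inversions w
      ≡⟨ cong (λ x → suc x + inversions w) smaller-than-c ⟨
    suc (smallerBefore + smallerAfter + inversions w)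
      ≡⟨ cong suc (regroup smallerBefore smallerAfter (inversions w)) ⟩
    suc (smallerBefore + (inversions w + smallerAfter))
      ≡⟨ cong (λ x → suc (smallerBefore + x)) cancel ⟩
    suc (smallerBefore + (inversions v + smallerBefore))
      ≡⟨ cong suc (trans (+-comm smallerBefore _) (+-assoc (inversions v) smallerBefore smallerBefore)) ⟩
    suc (inversions v + (smallerBefore + smallerBefore))
      ∎
    where
    regroup : ∀ a b c → a + b + c ≡ a + (c + b)
    regroup = solve-∀
    cancel : inversions w + smallerAfter ≡ inversions v + smallerBefore
    cancel = +-cancelˡ-≡ largerBefore _ _ (begin
      largerBefore + (inversions w + smallerAfter)
        ≡⟨ x+[y+z]≡y+x+z largerBefore (inversions w) smallerAfter ⟩
      inversions w + largerBefore + smallerAfter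
        ≡⟨ inversions-tail ⟩
      inversions v + k′
        ≡⟨ cong (inversions v +_) before-k ⟨
      inversions v + (largerBefore + smallerBefore)
        ≡⟨ x+[y+z]≡y+[x+z] (inversions v) largerBefore smallerBefore ⟩
      largerBefore + (inversions v + smallerBefore)
        ∎)
      where
      x+[y+z]≡y+x+z : ∀ h a b → h + (a + b) ≡ a + h + b
      x+[y+z]≡y+x+z = solve-∀
      x+[y+z]≡y+[x+z] : ∀ a h b → a + (h + b) ≡ h + (a + b)
      x+[y+z]≡y+[x+z] = solve-∀

  π-perm : IsPermutation π
  π-perm = prepend-perm (suc c) σ-perm

  step : ∀ y → (lookup σ y ≡ c × lookup π (suc y) ≡ zero) ⊎ (lookup σ y ≢ c × lookup π (suc y) ≡ suc (lookup σ y))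
  step y with lookup σ y ≟ c
  ... | yes σy≡c = inj₁ (σy≡c , trans (lookup-prepend (suc c) σ y) (trans (cong (relabel (suc c)) σy≡c) (relabel-self c)))
  ... | no  σy≢c = inj₂ (σy≢c , trans (lookup-prepend (suc c) σ y) (relabel-other σy≢c))

  -- Away from 0, π acts on suc x as σ acts on x, except that the step from σ⁻¹ c goes through 0 first.
  trace-π : ∀ t x → (iter π t (suc x) ≡ zero × Reaches σ x c) ⊎ ∃ λ s → iter π t (suc x) ≡ suc (iter σ s x)
  trace-π zero    x = inj₂ (0 , refl)
  trace-π (suc t) x with trace-π t x
  ... | inj₁ (πᵗ≡0 , s , σˢx≡c) = inj₂ (s , trans (cong (lookup π) πᵗ≡0) (cong suc (sym σˢx≡c)))
  ... | inj₂ (s , πᵗ≡σˢ) with step (iter σ s x)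
  ...   | inj₁ (σˢ⁺¹x≡c , e) = inj₁ (trans (cong (lookup π) πᵗ≡σˢ) e , suc s , σˢ⁺¹x≡c)
  ...   | inj₂ (_ , e)       = inj₂ (suc s , trans (cong (lookup π) πᵗ≡σˢ) e)

  trace-σ : ∀ s x → ∃ λ t → iter π t (suc x) ≡ suc (iter σ s x)
  trace-σ zero    x = 0 , refl
  trace-σ (suc s) x with trace-σ s x
  ... | t , πᵗ≡σˢ with step (iter σ s x)
  ...   | inj₁ (σˢ⁺¹x≡c , e) =
    suc (suc t) , trans (cong (λ y → lookup π (lookup π y)) πᵗ≡σˢ) (trans (cong (lookup π) e) (cong suc (sym σˢ⁺¹x≡c)))
  ...   | inj₂ (_ , e)       = suc t , trans (cong (lookup π) πᵗ≡σˢ) e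

  cycleMin-shift : ∀ x → So (isCycleMin π (suc x)) → So (isCycleMin σ x)
  cycleMin-shift x h = isCycleMin⁻ σ x (λ s → let t , πᵗ≡σˢ = trace-σ s x in
    s≤s⁻¹ (subst (λ y → suc (toℕ x) ≤ toℕ y) πᵗ≡σˢ (isCycleMin⁺ π π-perm (suc x) h t)))

  lost-cycleMin⇒reaches-c : ∀ x → So (isCycleMin σ x) → ¬ So (isCycleMin π (suc x)) → Reaches σ x c
  lost-cycleMin⇒reaches-c x h ¬h′ with So-all-allFin-¬ {suc m} _ ¬h′
  ... | t , below with trace-π (suc (toℕ t)) x
  ...   | inj₁ (_ , x→c)   = x→c
  ...   | inj₂ (s , πᵗ≡σˢ) = ⊥-elim (<⇒≱ (s≤s⁻¹ (subst (λ y → toℕ y < suc (toℕ x)) πᵗ≡σˢ π-below)) (isCycleMin⁺ σ σ-perm x h s))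
    where
    π-below : toℕ (iter π (suc (toℕ t)) (suc x)) < suc (toℕ x)
    π-below = <ᵇ⇒< _ _ (decidable-stable (T? _) (below ∘ So-not⁻))

  reaches-c⇒lost-cycleMin : ∀ x → Reaches σ x c → ¬ So (isCycleMin π (suc x))
  reaches-c⇒lost-cycleMin x x→c h with reaches-in-≥1-steps σ σ-perm x→c
  ... | s , σˢ⁺¹x≡c with trace-σ s x | step (iter σ s x)
  ...   | _ , _     | inj₂ (σˢ⁺¹x≢c , _) = σˢ⁺¹x≢c σˢ⁺¹x≡c
  ...   | t , πᵗ≡σˢ | inj₁ (_ , e)      =
    <⇒≱ (s≤s z≤n) (subst (λ y → suc (toℕ x) ≤ toℕ y) (trans (cong (lookup π) πᵗ≡σˢ) e)
                         (isCycleMin⁺ π π-perm (suc x) h (suc t)))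

  -- Exactly one cycle of σ loses its minimum: the one through c, which π merges with the fixed point 0.
  lostMin : Fin m → Bool
  lostMin x = isCycleMin σ x ∧ not (isCycleMin π (suc x))

  #lostMin : ∑ (indicator ∘ lostMin) ≡ 1
  #lostMin with orbit-minimum σ σ-perm c
  ... | x₀ , (a , σᵃc≡x₀) , x₀-min = trans (∑-single x₀ others) (cong indicator (to T-≡ x₀-lost))
    where
    x₀-cycleMin : CycleMin σ x₀
    x₀-cycleMin t =
      subst (λ y → toℕ x₀ ≤ toℕ y) (trans (iter-+ σ t a c) (cong (iter σ t) σᵃc≡x₀)) (x₀-min (t + a))
    x₀-lost : So (lostMin x₀)
    x₀-lost = from T-∧ ( isCycleMin⁻ σ x₀ x₀-cycleMin
                       , So-not⁻ (reaches-c⇒lost-cycleMin x₀ (reaches-sym σ σ-perm (a , σᵃc≡x₀))))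
    only-x₀ : ∀ y → So (lostMin y) → y ≡ x₀
    only-x₀ y lost = toℕ-injective (≤-antisym y≤x₀ x₀≤y)
      where
      y-min : So (isCycleMin σ y)
      y-min = proj₁ (to T-∧ lost)
      y→c : Reaches σ y c
      y→c = lost-cycleMin⇒reaches-c y y-min (So-not⁺ (proj₂ (to (T-∧ {isCycleMin σ y}) lost)))
      y≤x₀ : toℕ y ≤ toℕ x₀
      y≤x₀ = let t , σᵗy≡x₀ = reaches-trans σ y→c (a , σᵃc≡x₀) in
             subst (λ z → toℕ y ≤ toℕ z) σᵗy≡x₀ (isCycleMin⁺ σ σ-perm y y-min t)
      x₀≤y : toℕ x₀ ≤ toℕ y
      x₀≤y = let t , σᵗc≡y = reaches-sym σ σ-perm y→c in subst (λ z → toℕ x₀ ≤ toℕ z) σᵗc≡y (x₀-min t)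
    others : ∀ y → y ≢ x₀ → indicator (lostMin y) ≡ 0
    others y y≢x₀ = indicator-false (y≢x₀ ∘ only-x₀ y)

  cycleMin-split : ∀ x → indicator (isCycleMin σ x) ≡ indicator (isCycleMin π (suc x)) + indicator (lostMin x)
  cycleMin-split x with isCycleMin π (suc x) in eq
  ... | true  rewrite to T-≡ (cycleMin-shift x (from T-≡ eq)) = refl
  ... | false = cong indicator (sym (∧-identityʳ _))

  cyc-prepend-suc : cyc π ≡ cyc σ
  cyc-prepend-suc = begin
    cyc π
      ≡⟨ cyc≡∑ π ⟩
    indicator (isCycleMin π zero) + ∑ (indicator ∘ isCycleMin π ∘ suc)
      ≡⟨ cong (_+ ∑ (indicator ∘ isCycleMin π ∘ suc)) (cong indicator (to T-≡ (isCycleMin-zero π))) ⟩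
    1 + ∑ (indicator ∘ isCycleMin π ∘ suc)
      ≡⟨ +-comm 1 _ ⟩
    ∑ (indicator ∘ isCycleMin π ∘ suc) + 1
      ≡⟨ cong (∑ (indicator ∘ isCycleMin π ∘ suc) +_) #lostMin ⟨
    ∑ (indicator ∘ isCycleMin π ∘ suc) + ∑ (indicator ∘ lostMin)
      ≡⟨ ∑-distrib-+ {m} _ _ ⟨
    ∑ (λ x → indicator (isCycleMin π (suc x)) + indicator (lostMin x))
      ≡⟨ sum-cong-≗ cycleMin-split ⟨
    ∑ (indicator ∘ isCycleMin σ)
      ≡⟨ cyc≡∑ σ ⟨
    cyc σ
      ∎

  T-prepend-suc : T π ≡ suc (T σ)
  T-prepend-suc = trans (cong (suc m ∸_) cyc-prepend-suc) (+-∸-assoc 1 (cyc≤n σ))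

  I+T-prepend-suc : I π + T π ≡ suc (suc (I σ + T σ + (smallerBefore + smallerBefore)))
  I+T-prepend-suc = begin
    I π + T π
      ≡⟨ cong₂ _+_ (trans (I≡inversions π) inversions-prepend) T-prepend-suc ⟩
    suc (inversions v + (smallerBefore + smallerBefore)) + suc (T σ)
      ≡⟨ regroup (inversions v) (T σ) smallerBefore ⟩
    suc (suc (inversions v + T σ + (smallerBefore + smallerBefore)))
      ≡⟨ cong (λ i → suc (suc (i + T σ + (smallerBefore + smallerBefore)))) (I≡inversions σ) ⟨
    suc (suc (I σ + T σ + (smallerBefore + smallerBefore)))
      ∎
    where
    regroup : ∀ a t g → suc (a + (g + g)) + suc t ≡ suc (suc (a + t + (g + g)))
    regroup = solve-∀

  smallerBefore≤M : smallerBefore ≤ M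
  smallerBefore≤M = ⊓-glb (≤-trans (m≤m+n smallerBefore smallerAfter) (≤-reflexive smaller-than-c))
                          (≤-trans (∑-mono-≤ {m} (λ i → indicator-∧-≤ (toℕ i <ᵇ k′) (v i <ᵇ v k)))
                                   (≤-reflexive #below-k))
    where
    indicator-∧-≤ : ∀ a b → indicator (a ∧ b) ≤ indicator a
    indicator-∧-≤ true  true  = ≤-refl
    indicator-∧-≤ true  false = z≤n
    indicator-∧-≤ false _     = z≤n

  w≤suc-v : ∀ i → w i ≤ suc (v i)
  w≤suc-v i with i ≟ k
  ... | yes refl = subst (_≤ suc (v k)) (sym w-k) z≤n
  ... | no  i≢k  = ≤-reflexive (w-other i≢k)

  positive⇒≢k : ∀ {i} → 0 < w i → i ≢ k
  positive⇒≢k 0<wi refl = <-irrefl (sym w-k) 0<wi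

  avoids⇒smallerBefore≡0 : ¬ Contains321 π → smallerBefore ≡ 0
  avoids⇒smallerBefore≡0 π-avoids = ∑-zero (λ i → indicator-false (λ h → π-avoids (witness i (to T-∧ h))))
    where
    witness : ∀ i → So (toℕ i <ᵇ k′) × So (v i <ᵇ v k) → Contains321 π
    witness i (i<ᵇk , vi<ᵇvk) = occurrence zero (suc i) (suc k) (s≤s z≤n) (s≤s i<k)
      (subst (_< suc c′) (sym wi≡) (s≤s (subst (v i <_) v-k (<ᵇ⇒< _ _ vi<ᵇvk))))
      (subst₂ _<_ (sym w-k) (sym wi≡) (s≤s z≤n))
      where
      i<k : toℕ i < k′
      i<k = <ᵇ⇒< _ _ i<ᵇk
      wi≡ : w i ≡ suc (v i)
      wi≡ = w-other (λ { refl → <-irrefl refl i<k })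

  shift-occurrence : ∀ {i j l} → i ≢ k → j ≢ k →
                     toℕ i < toℕ j → toℕ j < toℕ l → v j < v i → v l < v j → Contains321 π
  shift-occurrence {i} {j} {l} i≢k j≢k i<j j<l vj<vi vl<vj = occurrence (suc i) (suc j) (suc l) (s≤s i<j) (s≤s j<l)
    (subst₂ _<_ (sym (w-other j≢k)) (sym (w-other i≢k)) (s≤s vj<vi))
    (≤-<-trans (w≤suc-v l) (subst (suc (v l) <_) (sym (w-other j≢k)) (s≤s vl<vj)))

  π-avoids⇒σ-avoids : c′ ≡ 0 ⊎ k′ ≡ 0 → ¬ Contains321 π → ¬ Contains321 σ
  π-avoids⇒σ-avoids (inj₁ c≡0) π-avoids (occurrence i j l i<j j<l vj<vi vl<vj) =
    π-avoids (shift-occurrence (not-k (≤-<-trans z≤n vj<vi)) (not-k (≤-<-trans z≤n vl<vj)) i<j j<l vj<vi vl<vj)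
    where
    not-k : ∀ {x} → 0 < v x → x ≢ k
    not-k 0<vx refl = <-irrefl (sym (trans v-k c≡0)) 0<vx
  π-avoids⇒σ-avoids (inj₂ k≡0) π-avoids (occurrence i j l i<j j<l vj<vi vl<vj) with i ≟ k
  ... | no  i≢k  = π-avoids (shift-occurrence i≢k j≢k i<j j<l vj<vi vl<vj)
    where
    j≢k : j ≢ k
    j≢k refl = <⇒≱ i<j (subst (_≤ toℕ i) (sym k≡0) z≤n)
  ... | yes refl = π-avoids (occurrence zero (suc j) (suc l) (s≤s z≤n) (s≤s j<l)
      (subst (_< suc c′) (sym (w-other j≢k)) (s≤s (subst (v j <_) v-k vj<vi)))
      (subst₂ _<_ (sym (w-other l≢k)) (sym (w-other j≢k)) (s≤s vl<vj)))
    where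
    j≢k : j ≢ k
    j≢k refl = <-irrefl refl i<j
    l≢k : l ≢ k
    l≢k refl = <-irrefl refl (<-trans i<j j<l)

  σ-avoids⇒π-avoids : c′ ≡ 0 ⊎ k′ ≡ 0 → ¬ Contains321 σ → ¬ Contains321 π
  σ-avoids⇒π-avoids _ _ (occurrence zero    zero    _ () _ _ _)
  σ-avoids⇒π-avoids _ _ (occurrence (suc _) zero    _ () _ _ _)
  σ-avoids⇒π-avoids _ _ (occurrence _ (suc _)    zero _ () _ _)
  σ-avoids⇒π-avoids (inj₁ c≡0) _ (occurrence zero (suc j) (suc l) _ j<l wj<π₀ wl<wj) =
    n≮0 (subst (v j <_) c≡0 (s≤s⁻¹ (subst (_< suc c′) (w-other (positive⇒≢k (≤-<-trans z≤n wl<wj))) wj<π₀)))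
  σ-avoids⇒π-avoids (inj₂ k≡0) σ-avoids (occurrence zero (suc j) (suc l) _ j<l wj<π₀ wl<wj) =
    σ-avoids (occurrence k j l k<j (s≤s⁻¹ j<l)
      (subst (v j <_) (sym v-k) (s≤s⁻¹ (subst (_< suc c′) (w-other j≢k) wj<π₀)))
      (s≤s⁻¹ (subst₂ _<_ (w-other l≢k) (w-other j≢k) wl<wj)))
    where
    j≢k : j ≢ k
    j≢k = positive⇒≢k (≤-<-trans z≤n wl<wj)
    k<j : k′ < toℕ j
    k<j = subst (_< toℕ j) (sym k≡0) (n≢0⇒n>0 (λ j≡0 → j≢k (toℕ-injective (trans j≡0 (sym k≡0)))))
    l≢k : l ≢ k
    l≢k refl = <-asym k<j (s≤s⁻¹ j<l)
  σ-avoids⇒π-avoids k|c σ-avoids (occurrence (suc i) (suc j) (suc l) i<j j<l wj<wi wl<wj) with l ≟ k | k|c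
  ... | no  l≢k | _ = σ-avoids (occurrence i j l (s≤s⁻¹ i<j) (s≤s⁻¹ j<l)
      (s≤s⁻¹ (subst₂ _<_ (w-other j≢k) (w-other i≢k) wj<wi))
      (s≤s⁻¹ (subst₂ _<_ (w-other l≢k) (w-other j≢k) wl<wj)))
    where
    i≢k : i ≢ k
    i≢k = positive⇒≢k (≤-<-trans z≤n wj<wi)
    j≢k : j ≢ k
    j≢k = positive⇒≢k (≤-<-trans z≤n wl<wj)
  ... | yes refl | inj₂ k≡0 = n≮0 (subst (toℕ j <_) k≡0 (s≤s⁻¹ j<l))
  ... | yes refl | inj₁ c≡0 = σ-avoids (occurrence i j k (s≤s⁻¹ i<j) (s≤s⁻¹ j<l)
      (s≤s⁻¹ (subst₂ _<_ (w-other j≢k) (w-other i≢k) wj<wi))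
      (subst (_< v j) (sym (trans v-k c≡0)) 0<vj))
    where
    i≢k : i ≢ k
    i≢k = positive⇒≢k (≤-<-trans z≤n wj<wi)
    j≢k : j ≢ k
    j≢k = positive⇒≢k (≤-<-trans z≤n wl<wj)
    0<vj : 0 < v j
    0<vj = n≢0⇒n>0 (λ vj≡0 → σ-other j≢k (toℕ-injective (trans vj≡0 (sym c≡0))))

T-prepend-zero : ∀ {m} (σ : Word m) → IsPermutation σ → T (prepend zero σ) ≡ T σ
T-prepend-zero {m} σ σ-perm = cong (suc m ∸_) (cyc-prepend-zero σ σ-perm)

I+T≤D : ∀ {n} (π : Word n) → IsPermutation π → I π + T π ≤ D π
I+T≤D {zero}  [] _ = z≤n
I+T≤D {suc m} π π-perm with prepend-surjective π π-perm
... | zero , σ , refl , σ-perm =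
  subst₂ _≤_ (sym (cong₂ _+_ (I-prepend-zero σ) (T-prepend-zero σ σ-perm))) (sym (D-prepend-zero σ)) (I+T≤D σ σ-perm)
... | suc c , σ , refl , σ-perm =
  subst₂ _≤_ (sym I+T-prepend-suc) (sym D-prepend-suc)
    (s≤s (s≤s (+-mono-≤ (I+T≤D σ σ-perm) (+-mono-≤ smallerBefore≤M smallerBefore≤M))))
  where open PrependSuc σ σ-perm c

-- Shallow 321-avoiding permutations

shallow321 : ∀ {n} → Word n → Bool
shallow321 π = shallow π ∧ avoids321 π

allowed : ∀ {m} → Word m → Fin (suc m) → Bool
allowed σ       zero          = true
allowed σ       (suc zero)    = true
allowed (h ∷ _) (suc (suc c)) = ⌊ h ≟ suc c ⌋

allowed-suc⇔ : ∀ {m} (σ : Word m) (σ-perm : IsPermutation σ) (c : Fin m) →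
               let open PrependSuc σ σ-perm c in So (allowed σ (suc c)) ⇔ (c′ ≡ 0 ⊎ k′ ≡ 0)
allowed-suc⇔ σ       σ-perm zero    = mk⇔ (λ _ → inj₁ refl) (λ _ → _)
allowed-suc⇔ (h ∷ τ) σ-perm (suc c) = mk⇔
  (λ h≡c → inj₂ (cong toℕ (σ-perm {_} {zero} (trans σk≡c (sym (toWitness {a? = h ≟ suc c} h≡c))))))
  (λ { (inj₁ ())
      ; (inj₂ k≡0) → fromWitness {a? = h ≟ suc c} (trans (cong (lookup (h ∷ τ)) (sym (toℕ-injective k≡0))) σk≡c)
      })
  where open PrependSuc (h ∷ τ) σ-perm (suc c)

⊓≡0 : ∀ {a b} → a ≡ 0 ⊎ b ≡ 0 → a ⊓ b ≡ 0
⊓≡0 {zero}           _          = refl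
⊓≡0 {suc a} {zero}   _          = refl
⊓≡0 {suc a} {suc b} (inj₁ ())
⊓≡0 {suc a} {suc b} (inj₂ ())

⊓≡0⁻ : ∀ {a b} → a ⊓ b ≡ 0 → a ≡ 0 ⊎ b ≡ 0
⊓≡0⁻ {zero}          _ = inj₁ refl
⊓≡0⁻ {suc a} {zero}  _ = inj₂ refl

-- D π − (I π + T π) = (D σ − (I σ + T σ)) + 2 (M − smallerBefore) is a sum of two non-negative terms;
-- 321-avoidance forces smallerBefore = 0, so π is shallow iff σ is and M = 0.
shallow321-prepend-suc : ∀ {m} (σ : Word m) (σ-perm : IsPermutation σ) (c : Fin m) →
                         shallow321 (prepend (suc c) σ) ≡ shallow321 σ ∧ allowed σ (suc c)
shallow321-prepend-suc σ σ-perm c = So-ext (mk⇔ forward backward)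
  where
  open PrependSuc σ σ-perm c
  forward : So (shallow321 π) → So (shallow321 σ ∧ allowed σ (suc c))
  forward h = from T-∧ ( from T-∧ (from (shallow⇔ σ) σ-shallow , from (avoids321⇔ σ) (π-avoids⇒σ-avoids c|k π-avoids))
                       , from (allowed-suc⇔ σ σ-perm c) c|k)
    where
    π-shallow : I π + T π ≡ D π
    π-shallow = to (shallow⇔ π) (proj₁ (to T-∧ h))
    π-avoids : ¬ Contains321 π
    π-avoids = to (avoids321⇔ π) (proj₂ (to T-∧ h))
    tight : I σ + T σ + 0 ≡ D σ + (M + M)
    tight = begin
      I σ + T σ + 0
        ≡⟨ cong (λ g → I σ + T σ + (g + g)) (avoids⇒smallerBefore≡0 π-avoids) ⟨
      I σ + T σ + (smallerBefore + smallerBefore)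
        ≡⟨ ℕ.suc-injective (ℕ.suc-injective (trans (sym I+T-prepend-suc) (trans π-shallow D-prepend-suc))) ⟩
      D σ + (M + M)
        ∎
    M+M≡0 : M + M ≡ 0
    M+M≡0 = n≤0⇒n≡0 (+-cancelˡ-≤ (D σ) (M + M) 0 (subst (_≤ D σ + 0) tight (+-monoˡ-≤ 0 (I+T≤D σ σ-perm))))
    c|k : c′ ≡ 0 ⊎ k′ ≡ 0
    c|k = ⊓≡0⁻ (m+n≡0⇒m≡0 M M+M≡0)
    σ-shallow : I σ + T σ ≡ D σ
    σ-shallow = +-cancelʳ-≡ 0 _ _ (trans tight (cong (λ x → D σ + x) M+M≡0))
  backward : So (shallow321 σ ∧ allowed σ (suc c)) → So (shallow321 π)
  backward h = from T-∧ (from (shallow⇔ π) π-shallow , from (avoids321⇔ π) (σ-avoids⇒π-avoids c|k σ-avoids))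
    where
    σ-sa : So (shallow321 σ)
    σ-sa = proj₁ (to T-∧ h)
    σ-avoids : ¬ Contains321 σ
    σ-avoids = to (avoids321⇔ σ) (proj₂ (to T-∧ σ-sa))
    c|k : c′ ≡ 0 ⊎ k′ ≡ 0
    c|k = to (allowed-suc⇔ σ σ-perm c) (proj₂ (to (T-∧ {shallow321 σ}) h))
    M≡0 : M ≡ 0
    M≡0 = ⊓≡0 c|k
    smallerBefore≡M : smallerBefore ≡ M
    smallerBefore≡M = trans (n≤0⇒n≡0 (subst (smallerBefore ≤_) M≡0 smallerBefore≤M)) (sym M≡0)
    π-shallow : I π + T π ≡ D π
    π-shallow = begin
      I π + T π
        ≡⟨ I+T-prepend-suc ⟩
      suc (suc (I σ + T σ + (smallerBefore + smallerBefore)))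
        ≡⟨ cong (λ g → suc (suc (I σ + T σ + (g + g)))) smallerBefore≡M ⟩
      suc (suc (I σ + T σ + (M + M)))
        ≡⟨ cong (λ d → suc (suc (d + (M + M)))) (to (shallow⇔ σ) (proj₁ (to T-∧ σ-sa))) ⟩
      suc (suc (D σ + (M + M)))
        ≡⟨ D-prepend-suc ⟨
      D π
        ∎

shallow321-prepend : ∀ {m} (x : Fin (suc m)) (σ : Word m) → IsPermutation σ →
                     shallow321 (prepend x σ) ≡ shallow321 σ ∧ allowed σ x
shallow321-prepend zero    σ σ-perm = trans
  (cong₂ _∧_ (cong₂ _≡ᵇ_ (cong₂ _+_ (I-prepend-zero σ) (T-prepend-zero σ σ-perm)) (D-prepend-zero σ))
             (avoids321-prepend-zero σ))
  (sym (∧-identityʳ (shallow321 σ)))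
shallow321-prepend (suc c) σ σ-perm = shallow321-prepend-suc σ σ-perm c

good : ∀ {n} → Word n → Bool
good π = isPerm π ∧ shallow321 π

distinct-relabel : ∀ {m} (x : Fin (suc m)) (σ : Word m) → distinct (Vec.map (relabel x) σ) ≡ isPerm σ
distinct-relabel x σ = So-ext (mk⇔
  (λ h → isPerm⁻ σ (λ {i} {j} eq → distinct⁺ (Vec.map (relabel x) σ) h {i} {j}
           (trans (lookup-map i (relabel x) σ) (trans (cong (relabel x) eq) (sym (lookup-map j (relabel x) σ))))))
  (λ h → proj₂ (to T-∧ (distinct⁻ (prepend x σ) (prepend-perm x (isPerm⁺ σ h))))))

count-good-prepend : ∀ m (P : Word (suc m) → Bool) →
  countᵇ (λ π → good π ∧ P π) (allVecs (suc m) (suc m))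
    ≡ ∑[ x < suc m ] countᵇ (λ σ → (good σ ∧ allowed σ x) ∧ P (prepend x σ)) (allVecs m m)
count-good-prepend m P = begin
  countᵇ (λ π → good π ∧ P π) (allVecs (suc m) (suc m))
    ≡⟨ countᵇ-allVecs-suc (suc m) m _ ⟩
  ∑[ x < suc m ] countᵇ (λ r → good (x ∷ r) ∧ P (x ∷ r)) (allVecs (suc m) m)
    ≡⟨ sum-cong-≗ (λ x → countᵇ-cong (split-fresh x) (allVecs (suc m) m)) ⟩
  ∑[ x < suc m ] countᵇ (λ r → fresh x r ∧ rest x r) (allVecs (suc m) m)
    ≡⟨ sum-cong-≗ (λ x → countᵇ-fresh m x (relabel x) (relabel-injective x) (relabel-≢ x) (rest x)) ⟩
  ∑[ x < suc m ] countᵇ (rest x ∘ Vec.map (relabel x)) (allVecs m m)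
    ≡⟨ sum-cong-≗ (λ x → countᵇ-cong (unfold-prepend x) (allVecs m m)) ⟩
  ∑[ x < suc m ] countᵇ (λ σ → (good σ ∧ allowed σ x) ∧ P (prepend x σ)) (allVecs m m)
    ∎
  where
  rest : ∀ x → Vec (Fin (suc m)) m → Bool
  rest x r = (distinct r ∧ shallow321 (x ∷ r)) ∧ P (x ∷ r)
  split-fresh : ∀ x r → good (x ∷ r) ∧ P (x ∷ r) ≡ fresh x r ∧ rest x r
  split-fresh x r rewrite So-ext (isPerm⇔distinct (x ∷ r)) | ∧-assoc (fresh x r) (distinct r) (shallow321 (x ∷ r)) =
    ∧-assoc (fresh x r) (distinct r ∧ shallow321 (x ∷ r)) (P (x ∷ r))
  unfold-prepend : ∀ x σ → rest x (Vec.map (relabel x) σ) ≡ (good σ ∧ allowed σ x) ∧ P (prepend x σ)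
  unfold-prepend x σ rewrite distinct-relabel x σ with isPerm σ in σ-perm
  ... | false = refl
  ... | true rewrite shallow321-prepend x σ (isPerm⁺ σ (from T-≡ σ-perm)) = refl

-- Counting by the first entry

countᵇ-∧-true : ∀ {A : Set} (p : A → Bool) xs → countᵇ (λ a → p a ∧ true) xs ≡ countᵇ p xs
countᵇ-∧-true p = countᵇ-cong (λ a → ∧-identityʳ (p a))

countᵇ-∧-false : ∀ {A : Set} (p : A → Bool) xs → countᵇ (λ a → p a ∧ false) xs ≡ 0
countᵇ-∧-false p xs = trans (countᵇ-cong (λ a → ∧-zeroʳ (p a)) xs) (countᵇ-false xs)

#good : ℕ → ℕ
#good n = countᵇ good (allVecs n n)

#goodAllowing : ∀ m → Fin (suc m) → ℕ
#goodAllowing m x = countᵇ (λ σ → good σ ∧ allowed σ x) (allVecs m m)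

#good-suc : ∀ m → #good (suc m) ≡ ∑[ x < suc m ] #goodAllowing m x
#good-suc m = begin
  #good (suc m)
    ≡⟨ countᵇ-∧-true good (allVecs (suc m) (suc m)) ⟨
  countᵇ (λ π → good π ∧ true) (allVecs (suc m) (suc m))
    ≡⟨ count-good-prepend m (λ _ → true) ⟩
  ∑[ x < suc m ] countᵇ (λ σ → (good σ ∧ allowed σ x) ∧ true) (allVecs m m)
    ≡⟨ sum-cong-≗ (λ x → countᵇ-∧-true (λ σ → good σ ∧ allowed σ x) (allVecs m m)) ⟩
  ∑[ x < suc m ] #goodAllowing m x
    ∎

#good-head : ∀ m (y : Fin (suc m)) →
             countᵇ (λ π → good π ∧ ⌊ Vec.head π ≟ y ⌋) (allVecs (suc m) (suc m)) ≡ #goodAllowing m y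
#good-head m y = begin
  countᵇ (λ π → good π ∧ ⌊ Vec.head π ≟ y ⌋) (allVecs (suc m) (suc m))
    ≡⟨ count-good-prepend m (λ π → ⌊ Vec.head π ≟ y ⌋) ⟩
  ∑[ x < suc m ] countᵇ (λ σ → (good σ ∧ allowed σ x) ∧ ⌊ x ≟ y ⌋) (allVecs m m)
    ≡⟨ ∑-single y only-y ⟩
  countᵇ (λ σ → (good σ ∧ allowed σ y) ∧ ⌊ y ≟ y ⌋) (allVecs m m)
    ≡⟨ at-y ⟩
  #goodAllowing m y
    ∎
  where
  only-y : ∀ x → x ≢ y → countᵇ (λ σ → (good σ ∧ allowed σ x) ∧ ⌊ x ≟ y ⌋) (allVecs m m) ≡ 0
  only-y x x≢y with x ≟ y
  ... | yes x≡y = ⊥-elim (x≢y x≡y)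
  ... | no  _   = countᵇ-∧-false (λ σ → good σ ∧ allowed σ x) (allVecs m m)
  at-y : countᵇ (λ σ → (good σ ∧ allowed σ y) ∧ ⌊ y ≟ y ⌋) (allVecs m m) ≡ #goodAllowing m y
  at-y with y ≟ y
  ... | yes _ = countᵇ-∧-true (λ σ → good σ ∧ allowed σ y) (allVecs m m)
  ... | no y≢y = ⊥-elim (y≢y refl)

#goodAllowing-zero : ∀ m → #goodAllowing m zero ≡ #good m
#goodAllowing-zero m = countᵇ-∧-true good (allVecs m m)

#goodAllowing-one : ∀ m → #goodAllowing (suc m) (suc zero) ≡ #good (suc m)
#goodAllowing-one m = countᵇ-∧-true good (allVecs (suc m) (suc m))

#goodAllowing-suc-suc : ∀ m (c : Fin m) → #goodAllowing (suc m) (suc (suc c)) ≡ #goodAllowing m (suc c)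
#goodAllowing-suc-suc m c = trans (countᵇ-cong (λ { (h ∷ τ) → refl }) (allVecs (suc m) (suc m))) (#good-head m (suc c))

#goodAllowingSuc : ℕ → ℕ
#goodAllowingSuc m = ∑[ c < m ] #goodAllowing m (suc c)

#good-rec : ∀ m → #good (suc m) ≡ #good m + #goodAllowingSuc m
#good-rec m = trans (#good-suc m) (cong (_+ #goodAllowingSuc m) (#goodAllowing-zero m))

#goodAllowingSuc-rec : ∀ m → #goodAllowingSuc (suc m) ≡ #good (suc m) + #goodAllowingSuc m
#goodAllowingSuc-rec m = cong₂ _+_ (#goodAllowing-one m) (sum-cong-≗ (#goodAllowing-suc-suc m))

#good-fib : ∀ m → #good (suc m) ≡ fib (suc (m + m)) × #goodAllowingSuc m ≡ fib (m + m)
#good-fib zero    = refl , refl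
#good-fib (suc m) with #good-fib m
... | good≡ , allowingSuc≡ = good≡′ , allowingSuc≡′
  where
  allowingSuc≡′ : #goodAllowingSuc (suc m) ≡ fib (suc m + suc m)
  allowingSuc≡′ = begin
    #goodAllowingSuc (suc m)                ≡⟨ #goodAllowingSuc-rec m ⟩
    #good (suc m) + #goodAllowingSuc m      ≡⟨ cong₂ _+_ good≡ allowingSuc≡ ⟩
    fib (suc (suc (m + m)))                 ≡⟨ cong (fib ∘ suc) (+-suc m m) ⟨
    fib (suc m + suc m)                     ∎
  good≡′ : #good (suc (suc m)) ≡ fib (suc (suc m + suc m))
  good≡′ = begin
    #good (suc (suc m))                            ≡⟨ #good-rec (suc m) ⟩
    #good (suc m) + #goodAllowingSuc (suc m)       ≡⟨ cong₂ _+_ good≡ allowingSuc≡′ ⟩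
    fib (suc (m + m)) + fib (suc m + suc m)        ≡⟨ +-comm (fib (suc (m + m))) _ ⟩
    fib (suc m + suc m) + fib (suc (m + m))        ≡⟨ cong (λ n → fib (suc m + suc m) + fib n) (+-suc m m) ⟨
    fib (suc (suc m + suc m))                      ∎

theorem6p1 : (n : ℕ) → 1 ≤ n → t321 n ≡ fib (2 * n ∸ 1)
theorem6p1 (suc m) _ = begin
  t321 (suc m)           ≡⟨ proj₁ (#good-fib m) ⟩
  fib (suc (m + m))      ≡⟨ cong fib (odd m) ⟨
  fib (2 * suc m ∸ 1)    ∎
  where
  odd : ∀ m → m + suc (m + 0) ≡ suc (m + m)
  odd = solve-∀
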